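{- Let $(x,y)\in\mathbb{Z}_{\geq0}^2$ with $(x,y)\notin P_1$. If there is $t$ with $1\le t\le\min(x,y)$ and $(x-t,y-t)\in P_0$, then there is $s$ with $1\le s\le\min(x,y)$ and $(x-s,y-s)\in P_1$.
   Context: $\phi=\frac{1+\sqrt5}2$. $P_0=\{(\lfloor n\phi\rfloor,\lfloor n(\phi+1)\rfloor):n\in\mathbb{Z}_{\geq0}\}\cup\{(\lfloor n(\phi+1)\rfloor,\lfloor n\phi\rfloor):n\in\mathbb{Z}_{\geq0}\}$. $g:\mathbb{Z}_{\geq0}\to\{0,1\}$ is defined by $g(0)=1$, $g(1)=0$ and, for $n\ge2$, $g(n)=1-g(m)$ if there is $m\in\mathbb{Z}_{\geq0}$ with $\lfloor n\phi\rfloor=\lfloor m(\phi+1)\rfloor+1$, and $g(n)=1$ otherwise. $P_1=\{(\lfloor n\phi\rfloor+g(n)-1,\lfloor n(\phi+1)\rfloor+g(n)):n\ge0\}\cup\{(\lfloor n(\phi+1)\rfloor+g(n),\lfloor n\phi\rfloor+g(n)-1):n\ge0\}\cup\{(0,0),(1,1)\}$. -}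

module Defs where

open import Data.Nat using (ℕ; zero; suc; _+_; _*_; _∸_; _/_; _≤_; _≤ᵇ_; _≡ᵇ_)
open import Data.Bool using (Bool; true; false; if_then_else_)
open import Data.Maybe using (Maybe; just; nothing)
open import Data.Product using (_×_; ∃)
open import Data.Sum using (_⊎_)
open import Relation.Binary.PropositionalEquality using (_≡_)

isqrt : ℕ → ℕ
isqrt zero = zero
isqrt (suc m) = step (isqrt m)
  where
  step : ℕ → ℕ
  step r = if suc r * suc r ≤ᵇ suc m then suc r else r

-- A n = ⌊ n φ ⌋ = ⌊ (n + √(5 n²)) / 2 ⌋ = ⌊ (n + ⌊√(5n²)⌋) / 2 ⌋
A : ℕ → ℕ
A n = (n + isqrt (5 * (n * n))) / 2

-- B n = ⌊ n (φ + 1) ⌋ = ⌊ n φ ⌋ + n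
B : ℕ → ℕ
B n = A n + n

search : ℕ → ℕ → Maybe ℕ
search zero v = if v ≡ᵇ (B zero + 1) then just zero else nothing
search (suc k) v = if v ≡ᵇ (B (suc k) + 1) then just (suc k) else search k v

-- g with fuel; any such m satisfies m < n, so fuel suc n suffices
gF : ℕ → ℕ → ℕ
gF zero n = 1
gF (suc f) zero = 1
gF (suc f) (suc zero) = 0
gF (suc f) (suc (suc k)) with search (suc (suc k)) (A (suc (suc k)))
... | just m  = 1 ∸ gF f m
... | nothing = 1

g : ℕ → ℕ
g n = gF (suc n) n

InP0 : ℕ → ℕ → Set
InP0 x y = ∃ λ n → (x ≡ A n × y ≡ B n) ⊎ (x ≡ B n × y ≡ A n)

-- A n + g n ≥ 1 always, so truncated subtraction is exact here
InP1 : ℕ → ℕ → Set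
InP1 x y =
  (∃ λ n → (x ≡ A n + g n ∸ 1 × y ≡ B n + g n) ⊎ (x ≡ B n + g n × y ≡ A n + g n ∸ 1))
  ⊎ ((x ≡ 0 × y ≡ 0) ⊎ (x ≡ 1 × y ≡ 1))

-- The point (A n, B n) of P₀ lies on the diagonal y − x = n. So does a point of P₁ that is
-- not above it: (0, 0) when n = 0, and for n = m + 1 the point (A m + g m − 1, B m + g m),
-- because B m − A m = m and A m + g m − 1 ≤ A m ≤ A (m + 1) (A is monotone and g ≤ 1).
-- Sliding down the diagonal from (A n + t, B n + t) by at least t therefore reaches P₁.
module Submission where

open import Defs
open import Data.Nat using (ℕ; zero; suc; _+_; _*_; _∸_; _≤_; _<_; _≤ᵇ_; z≤n; s≤s)
open import Data.Nat.Properties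
open import Data.Nat.DivMod using (/-monoˡ-≤)
open import Algebra.Properties.CommutativeSemigroup +-commutativeSemigroup using (xy∙z≈xz∙y)
open import Data.Bool using (true; false)
open import Data.Maybe using (just; nothing)
open import Data.Product using (_×_; ∃; _,_)
open import Data.Sum using (inj₁; inj₂)
open import Relation.Nullary using (¬_)
open import Relation.Binary.PropositionalEquality
  using (_≡_; refl; sym; trans; cong; subst₂; module ≡-Reasoning)

isqrt-≤-suc : ∀ m → isqrt m ≤ isqrt (suc m)
isqrt-≤-suc m with suc (isqrt m) * suc (isqrt m) ≤ᵇ suc m
... | true  = n≤1+n (isqrt m)
... | false = ≤-refl

isqrt-mono-≤ : ∀ {m n} → m ≤ n → isqrt m ≤ isqrt n
isqrt-mono-≤ {n = zero}  z≤n = ≤-refl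
isqrt-mono-≤ {n = suc n} m≤1+n with m≤n⇒m<n∨m≡n m≤1+n
... | inj₁ (s≤s m≤n) = ≤-trans (isqrt-mono-≤ m≤n) (isqrt-≤-suc n)
... | inj₂ refl      = ≤-refl

A-mono-≤ : ∀ {m n} → m ≤ n → A m ≤ A n
A-mono-≤ m≤n =
  /-monoˡ-≤ 2 (+-mono-≤ m≤n (isqrt-mono-≤ (*-monoʳ-≤ 5 (*-mono-≤ m≤n m≤n))))

gF≤1 : ∀ fuel n → gF fuel n ≤ 1
gF≤1 zero    n                = ≤-refl
gF≤1 (suc _) zero             = ≤-refl
gF≤1 (suc _) (suc zero)       = z≤n
gF≤1 (suc f) (suc (suc k)) with search (suc (suc k)) (A (suc (suc k)))
... | just m  = m∸n≤m 1 (gF f m)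
... | nothing = ≤-refl

g≤1 : ∀ n → g n ≤ 1
g≤1 n = gF≤1 (suc n) n

1≤A+g : ∀ n → 1 ≤ A n + g n
1≤A+g zero    = ≤-refl
1≤A+g (suc n) = ≤-trans (A-mono-≤ {1} {suc n} (s≤s z≤n)) (m≤m+n (A (suc n)) (g (suc n)))

A₁ B₁ : ℕ → ℕ
A₁ n = A n + g n ∸ 1
B₁ n = B n + g n

B₁≡A₁+suc : ∀ n → B₁ n ≡ A₁ n + suc n
B₁≡A₁+suc n = begin
  A n + n + g n         ≡⟨ xy∙z≈xz∙y (A n) n (g n) ⟩
  A n + g n + n         ≡⟨ cong (_+ n) (m∸n+n≡m (1≤A+g n)) ⟨
  A₁ n + 1 + n          ≡⟨ +-assoc (A₁ n) 1 n ⟩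
  A₁ n + suc n          ∎
  where open ≡-Reasoning

A₁≤A-suc : ∀ n → A₁ n ≤ A (suc n)
A₁≤A-suc n = begin
  A n + g n ∸ 1  ≤⟨ ∸-monoˡ-≤ 1 (+-monoʳ-≤ (A n) (g≤1 n)) ⟩
  A n + 1 ∸ 1    ≡⟨ m+n∸n≡m (A n) 1 ⟩
  A n            ≤⟨ A-mono-≤ (n≤1+n n) ⟩
  A (suc n)      ∎
  where open ≤-Reasoning

InP1-sym : ∀ {x y} → InP1 x y → InP1 y x
InP1-sym (inj₁ (n , inj₁ (x≡ , y≡))) = inj₁ (n , inj₂ (y≡ , x≡))
InP1-sym (inj₁ (n , inj₂ (x≡ , y≡))) = inj₁ (n , inj₁ (y≡ , x≡))
InP1-sym (inj₂ (inj₁ (x≡ , y≡)))     = inj₂ (inj₁ (y≡ , x≡))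
InP1-sym (inj₂ (inj₂ (x≡ , y≡)))     = inj₂ (inj₂ (y≡ , x≡))

InP1-on-diagonal-below-A : ∀ d → ∃ λ p → p ≤ A d × InP1 p (p + d)
InP1-on-diagonal-below-A zero    = 0 , z≤n , inj₂ (inj₁ (refl , refl))
InP1-on-diagonal-below-A (suc n) =
  A₁ n , A₁≤A-suc n , inj₁ (n , inj₁ (refl , sym (B₁≡A₁+suc n)))

DescendsToP1 : ℕ → ℕ → Set
DescendsToP1 x y = ∃ λ s → 1 ≤ s × s ≤ x × s ≤ y × InP1 (x ∸ s) (y ∸ s)

DescendsToP1-sym : ∀ {x y} → DescendsToP1 x y → DescendsToP1 y x
DescendsToP1-sym (s , 1≤s , s≤x , s≤y , p) = s , 1≤s , s≤y , s≤x , InP1-sym p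

DescendsToP1-diagonal : ∀ {p x} d → p < x → InP1 p (p + d) → DescendsToP1 x (x + d)
DescendsToP1-diagonal {p} {x} d p<x p∈P1 =
  x ∸ p , m<n⇒0<n∸m p<x , s≤x , ≤-trans s≤x (m≤m+n x d) ,
  subst₂ InP1 (sym x∸s≡p) (sym x+d∸s≡p+d) p∈P1
  where
  s≤x : x ∸ p ≤ x
  s≤x = m∸n≤m x p
  x∸s≡p : x ∸ (x ∸ p) ≡ p
  x∸s≡p = m∸[m∸n]≡n (<⇒≤ p<x)
  x+d∸s≡p+d : x + d ∸ (x ∸ p) ≡ p + d
  x+d∸s≡p+d = trans (+-∸-comm d s≤x) (cong (_+ d) x∸s≡p)

DescendsToP1-above-A : ∀ d {x} → A d < x → DescendsToP1 x (x + d)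
DescendsToP1-above-A d A<x with InP1-on-diagonal-below-A d
... | p , p≤A , p∈P1 = DescendsToP1-diagonal d (≤-<-trans p≤A A<x) p∈P1

DescendsToP1-above-P0 : ∀ n {x y t} → 1 ≤ t → t ≤ x → t ≤ y →
  x ∸ t ≡ A n → y ∸ t ≡ B n → DescendsToP1 x y
DescendsToP1-above-P0 n {x} {y} {t} 1≤t t≤x t≤y x∸t≡A y∸t≡B =
  subst₂ DescendsToP1 (sym x≡A+t) (sym y≡A+t+n)
    (DescendsToP1-above-A n (m<m+n (A n) 1≤t))
  where
  open ≡-Reasoning
  x≡A+t : x ≡ A n + t
  x≡A+t = trans (sym (m∸n+n≡m t≤x)) (cong (_+ t) x∸t≡A)
  y≡A+t+n : y ≡ A n + t + n
  y≡A+t+n = begin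
    y            ≡⟨ m∸n+n≡m t≤y ⟨
    y ∸ t + t    ≡⟨ cong (_+ t) y∸t≡B ⟩
    A n + n + t  ≡⟨ xy∙z≈xz∙y (A n) n t ⟩
    A n + t + n  ∎

lemma3p7 : (x y : ℕ) → ¬ InP1 x y →
    (∃ λ t → 1 ≤ t × t ≤ x × t ≤ y × InP0 (x ∸ t) (y ∸ t)) →
    ∃ λ s → 1 ≤ s × s ≤ x × s ≤ y × InP1 (x ∸ s) (y ∸ s)
lemma3p7 x y _ (t , 1≤t , t≤x , t≤y , n , inj₁ (x∸t≡A , y∸t≡B)) =
  DescendsToP1-above-P0 n 1≤t t≤x t≤y x∸t≡A y∸t≡B
lemma3p7 x y _ (t , 1≤t , t≤x , t≤y , n , inj₂ (x∸t≡B , y∸t≡A)) =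
  DescendsToP1-sym (DescendsToP1-above-P0 n 1≤t t≤y t≤x y∸t≡A x∸t≡B)
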